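{- Let $\ddot{\mathbb A}$ be any BiKAT over a KAT $\mathbb A$. For actions $c,c'\in\mathbb A$ and bitests $P,Q$ write $c\mid c':P\approx> Q$ for the equation $P;\langle c\mid c'\rangle;\neg Q=0$. Then for all actions $c,c',d,d'\in\mathbb A$, tests $e,e'\in\mathbb B$ and bitests $P,Q,R,S\in\ddot{\mathbb B}$: (dSeq) if $c\mid c':P\approx>R$ and $d\mid d':R\approx>Q$ then $c;d\mid c';d':P\approx>Q$; (dIf) if $P\le \langle e\mid e'\rangle+\langle\neg e\mid\neg e'\rangle$, $c\mid c':P;\langle e\mid e'\rangle\approx>Q$ and $d\mid d':P;\langle\neg e\mid\neg e'\rangle\approx>Q$, then $(e;c+\neg e;d)\mid(e';c'+\neg e';d'):P\approx>Q$; (dWh) if $P\le \langle e\mid e'\rangle+\langle\neg e\mid\neg e'\rangle$ and $c\mid c':P;\langle e\mid e'\rangle\approx>P$, then $(e;c)^*;\neg e\mid (e';c')^*;\neg e':P\approx>P;\langle\neg e\mid\neg e'\rangle$; (rDisj) if $c\mid d:P\approx>Q$ and $c\mid d:R\approx>Q$ then $c\mid d:P+R\approx>Q$; (SeqSk) if $c\mid 1:P\approx>R$ and $d\mid 1:R\approx>Q$ then $c;d\mid 1:P\approx>Q$; (rConseq) if $R\le P$, $c\mid d:P\approx>Q$ and $Q\le S$ then $c\mid d:R\approx>S$.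
   Context: A KAT $(\mathbb A,\mathbb B,+,;,{}^*,\neg,1,0)$ is a Kleene algebra with a Boolean subalgebra $\mathbb B\subseteq\mathbb A$ of tests; $a\le b$ iff $a+b=b$. A BiKAT over $\mathbb A$ is a KAT $(\ddot{\mathbb A},\ddot{\mathbb B},\dots)$ with KAT homomorphisms $\langle\cdot\,],[\,\cdot\rangle:\mathbb A\to\ddot{\mathbb A}$ (preserving $0,1,+,;,{}^*$, mapping tests to tests, preserving test negation) satisfying $\langle x];[y\rangle=[y\rangle;\langle x]$ for all $x,y\in\mathbb A$; elements of $\ddot{\mathbb B}$ are bitests, and $\langle a\mid b\rangle:=\langle a];[b\rangle$. In program notation, $\mathsf{skip}=1$, $\mathsf{if}\ e\ \mathsf{then}\ c\ \mathsf{else}\ d = e;c+\neg e;d$, $\mathsf{while}\ e\ \mathsf{do}\ c=(e;c)^*;\neg e$; conjunction of bitests is $;$, disjunction is $+$, implication is $\le$. -}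

module Defs where

open import Level using (Level; _⊔_) renaming (suc to lsuc)
open import Relation.Binary.PropositionalEquality using (_≡_)
open import Data.Product using (_×_)

-- The tests form a Boolean subalgebra: a type Test with an
-- injective embedding ι into the carrier, closed under 0,1,+,; and with a
-- complement ¬ satisfying the Boolean laws (commutativity of ; on tests and
-- b + ¬b = 1, b ; ¬b = 0, which together with the idempotent semiring laws
-- make the image of ι a Boolean algebra).
record KAT (ℓ : Level) : Set (lsuc ℓ) where
  infixl 6 _+_
  infixl 7 _⨾_
  infix 4 _≤_
  field
    Carrier : Set ℓ
    _+_ _⨾_ : Carrier → Carrier → Carrier
    _* : Carrier → Carrier
    𝟘 𝟙 : Carrier

  _≤_ : Carrier → Carrier → Set ℓ
  a ≤ b = a + b ≡ b

  field
    +-assoc : ∀ a b c → (a + b) + c ≡ a + (b + c)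
    +-comm  : ∀ a b → a + b ≡ b + a
    +-idem  : ∀ a → a + a ≡ a
    +-identityˡ : ∀ a → 𝟘 + a ≡ a
    ⨾-assoc : ∀ a b c → (a ⨾ b) ⨾ c ≡ a ⨾ (b ⨾ c)
    ⨾-identityˡ : ∀ a → 𝟙 ⨾ a ≡ a
    ⨾-identityʳ : ∀ a → a ⨾ 𝟙 ≡ a
    ⨾-zeroˡ : ∀ a → 𝟘 ⨾ a ≡ 𝟘
    ⨾-zeroʳ : ∀ a → a ⨾ 𝟘 ≡ 𝟘
    distribˡ : ∀ a b c → a ⨾ (b + c) ≡ a ⨾ b + a ⨾ c
    distribʳ : ∀ a b c → (a + b) ⨾ c ≡ a ⨾ c + b ⨾ c
    *-unfoldˡ : ∀ a → 𝟙 + a ⨾ (a *) ≤ a *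
    *-unfoldʳ : ∀ a → 𝟙 + (a *) ⨾ a ≤ a *
    *-inductˡ : ∀ a b x → b + a ⨾ x ≤ x → (a *) ⨾ b ≤ x
    *-inductʳ : ∀ a b x → b + x ⨾ a ≤ x → b ⨾ (a *) ≤ x
    Test : Set ℓ
    ι : Test → Carrier
    ι-injective : ∀ p q → ι p ≡ ι q → p ≡ q
    t𝟘 t𝟙 : Test
    _t+_ _t⨾_ : Test → Test → Test
    ¬_ : Test → Test
    ι-𝟘 : ι t𝟘 ≡ 𝟘
    ι-𝟙 : ι t𝟙 ≡ 𝟙
    ι-+ : ∀ p q → ι (p t+ q) ≡ ι p + ι q
    ι-⨾ : ∀ p q → ι (p t⨾ q) ≡ ι p ⨾ ι q
    test-comm : ∀ p q → ι p ⨾ ι q ≡ ι q ⨾ ι p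
    test-excl : ∀ p → ι p ⨾ ι (¬ p) ≡ 𝟘
    test-compl : ∀ p → ι p + ι (¬ p) ≡ 𝟙

record KATHom {ℓ₁ ℓ₂ : Level} (A : KAT ℓ₁) (B : KAT ℓ₂) : Set (ℓ₁ ⊔ ℓ₂) where
  private
    module A = KAT A
    module B = KAT B
  field
    f : A.Carrier → B.Carrier
    f-𝟘 : f A.𝟘 ≡ B.𝟘
    f-𝟙 : f A.𝟙 ≡ B.𝟙
    f-+ : ∀ a b → f (a A.+ b) ≡ f a B.+ f b
    f-⨾ : ∀ a b → f (a A.⨾ b) ≡ f a B.⨾ f b
    f-* : ∀ a → f (a A.*) ≡ (f a) B.*
    fT : A.Test → B.Test
    fT-ι : ∀ p → B.ι (fT p) ≡ f (A.ι p)
    fT-¬ : ∀ p → fT (A.¬ p) ≡ B.¬ (fT p)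

record BiKAT {ℓ₁ : Level} (ℓ₂ : Level) (𝔸 : KAT ℓ₁) : Set (ℓ₁ ⊔ lsuc ℓ₂) where
  field
    Ä : KAT ℓ₂
    L : KATHom 𝔸 Ä
    R : KATHom 𝔸 Ä
  open KAT Ä
  field
    LR-comm : ∀ x y → KATHom.f L x ⨾ KATHom.f R y ≡ KATHom.f R y ⨾ KATHom.f L x

  ⟨_∣_⟩ : KAT.Carrier 𝔸 → KAT.Carrier 𝔸 → Carrier
  ⟨ a ∣ b ⟩ = KATHom.f L a ⨾ KATHom.f R b

  ⟨_∣_⟩ᵇ : KAT.Test 𝔸 → KAT.Test 𝔸 → Test
  ⟨ e ∣ e' ⟩ᵇ = KATHom.fT L e t⨾ KATHom.fT R e'

  _∣_∶_≈>_ : KAT.Carrier 𝔸 → KAT.Carrier 𝔸 → Test → Test → Set ℓ₂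
  c ∣ c' ∶ P ≈> Q = ι P ⨾ ⟨ c ∣ c' ⟩ ⨾ ι (¬ Q) ≡ 𝟘

module Rules {ℓ₁ ℓ₂ : Level} (𝔸 : KAT ℓ₁) (𝔹 : BiKAT ℓ₂ 𝔸) where
  open KAT 𝔸 using () renaming (_+_ to _+ₐ_; _⨾_ to _⨾ₐ_; _* to _*ₐ; 𝟙 to 𝟙ₐ; ι to ιₐ; ¬_ to ¬ₐ_)
  open BiKAT 𝔹
  open KAT Ä using (_≤_; _+_; ι; _t⨾_; _t+_)

  guardCover : KAT.Test 𝔸 → KAT.Test 𝔸 → KAT.Carrier Ä
  guardCover e e' = ι ⟨ e ∣ e' ⟩ᵇ + ι ⟨ ¬ₐ e ∣ ¬ₐ e' ⟩ᵇ

  dSeq : Set (ℓ₁ ⊔ ℓ₂)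
  dSeq = ∀ c c' d d' P Q R → c ∣ c' ∶ P ≈> R → d ∣ d' ∶ R ≈> Q →
         (c ⨾ₐ d) ∣ (c' ⨾ₐ d') ∶ P ≈> Q

  dIf : Set (ℓ₁ ⊔ ℓ₂)
  dIf = ∀ c c' d d' e e' P Q →
        ι P ≤ guardCover e e' →
        c ∣ c' ∶ (P t⨾ ⟨ e ∣ e' ⟩ᵇ) ≈> Q →
        d ∣ d' ∶ (P t⨾ ⟨ ¬ₐ e ∣ ¬ₐ e' ⟩ᵇ) ≈> Q →
        (ιₐ e ⨾ₐ c +ₐ ιₐ (¬ₐ e) ⨾ₐ d) ∣ (ιₐ e' ⨾ₐ c' +ₐ ιₐ (¬ₐ e') ⨾ₐ d') ∶ P ≈> Q

  dWh : Set (ℓ₁ ⊔ ℓ₂)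
  dWh = ∀ c c' e e' P →
        ι P ≤ guardCover e e' →
        c ∣ c' ∶ (P t⨾ ⟨ e ∣ e' ⟩ᵇ) ≈> P →
        (((ιₐ e ⨾ₐ c) *ₐ) ⨾ₐ ιₐ (¬ₐ e)) ∣ (((ιₐ e' ⨾ₐ c') *ₐ) ⨾ₐ ιₐ (¬ₐ e'))
          ∶ P ≈> (P t⨾ ⟨ ¬ₐ e ∣ ¬ₐ e' ⟩ᵇ)

  rDisj : Set (ℓ₁ ⊔ ℓ₂)
  rDisj = ∀ c d P Q R → c ∣ d ∶ P ≈> Q → c ∣ d ∶ R ≈> Q → c ∣ d ∶ (P t+ R) ≈> Q

  SeqSk : Set (ℓ₁ ⊔ ℓ₂)
  SeqSk = ∀ c d P Q R → c ∣ 𝟙ₐ ∶ P ≈> R → d ∣ 𝟙ₐ ∶ R ≈> Q → (c ⨾ₐ d) ∣ 𝟙ₐ ∶ P ≈> Q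

  rConseq : Set (ℓ₁ ⊔ ℓ₂)
  rConseq = ∀ c d P Q R S → ι R ≤ ι P → c ∣ d ∶ P ≈> Q → ι Q ≤ ι S → c ∣ d ∶ R ≈> S

-- A relational triple c ∣ c′ : P ≈> Q is the Hoare triple {P} ⟨c ∣ c′⟩ {Q} of the
-- BiKAT, and since ⟨·] and [·⟩ commute, ⟨·∣·⟩ turns sequencing and choice on both
-- sides into sequencing and choice in the BiKAT.  Hence dSeq, SeqSk, rDisj and
-- rConseq are the ordinary KAT Hoare rules.  For dIf and dWh the hypothesis
-- P ≤ ⟨e∣e′⟩ + ⟨¬e∣¬e′⟩ makes the mixed guards ⟨e∣¬e′⟩ and ⟨¬e∣e′⟩ unreachable from
-- P.  In dIf this kills the two mismatched branches; in dWh it keeps the two loops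
-- in lockstep: with a = ⟨e;c] and b = [e′;c′⟩ commuting, a* b* ≤ (a b)* (a* + b*),
-- P is invariant under (a b)* = ⟨e;c ∣ e′;c′⟩*, and from P the remaining a* or b*
-- can only exit.

module Submission where

open import Defs
open import Data.Product using (_×_; _,_; proj₁; proj₂)
open import Relation.Binary.Bundles using (Poset)
open import Relation.Binary.PropositionalEquality
import Relation.Binary.Reasoning.PartialOrder as PartialOrderReasoning

module KATProperties {ℓ} (K : KAT ℓ) where
  open KAT K

  +-identityʳ : ∀ a → a + 𝟘 ≡ a
  +-identityʳ a = trans (+-comm a 𝟘) (+-identityˡ a)

  ≤-reflexive : ∀ {a b} → a ≡ b → a ≤ b
  ≤-reflexive {a} refl = +-idem a

  ≤-refl : ∀ {a} → a ≤ a
  ≤-refl = ≤-reflexive refl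

  ≤-trans : ∀ {a b c} → a ≤ b → b ≤ c → a ≤ c
  ≤-trans {a} {b} {c} a≤b b≤c = begin
    a + c       ≡⟨ cong (a +_) b≤c ⟨
    a + (b + c) ≡⟨ +-assoc a b c ⟨
    (a + b) + c ≡⟨ cong (_+ c) a≤b ⟩
    b + c       ≡⟨ b≤c ⟩
    c           ∎
    where open ≡-Reasoning

  ≤-antisym : ∀ {a b} → a ≤ b → b ≤ a → a ≡ b
  ≤-antisym {a} {b} a≤b b≤a = trans (sym b≤a) (trans (+-comm b a) a≤b)

  ≤-poset : Poset ℓ ℓ ℓ
  ≤-poset = record
    { Carrier        = Carrier
    ; _≈_            = _≡_
    ; _≤_            = _≤_
    ; isPartialOrder = record
      { isPreorder = record
        { isEquivalence = isEquivalence
        ; reflexive     = ≤-reflexive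
        ; trans         = ≤-trans
        }
      ; antisym    = ≤-antisym
      }
    }

  module ≤-Reasoning = PartialOrderReasoning ≤-poset

  x≤x+y : ∀ a b → a ≤ a + b
  x≤x+y a b = trans (sym (+-assoc a a b)) (cong (_+ b) (+-idem a))

  y≤x+y : ∀ a b → b ≤ a + b
  y≤x+y a b = subst (b ≤_) (+-comm b a) (x≤x+y b a)

  +-lub : ∀ {a b c} → a ≤ c → b ≤ c → a + b ≤ c
  +-lub {a} {b} {c} a≤c b≤c = trans (+-assoc a b c) (trans (cong (a +_) b≤c) a≤c)

  +-mono : ∀ {a b c d} → a ≤ b → c ≤ d → a + c ≤ b + d
  +-mono a≤b c≤d = +-lub (≤-trans a≤b (x≤x+y _ _)) (≤-trans c≤d (y≤x+y _ _))

  ⨾-monoˡ : ∀ {a b c} → a ≤ b → a ⨾ c ≤ b ⨾ c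
  ⨾-monoˡ {a} {b} {c} a≤b = trans (sym (distribʳ a b c)) (cong (_⨾ c) a≤b)

  ⨾-monoʳ : ∀ {a b c} → b ≤ c → a ⨾ b ≤ a ⨾ c
  ⨾-monoʳ {a} {b} {c} b≤c = trans (sym (distribˡ a b c)) (cong (a ⨾_) b≤c)

  ⨾-mono : ∀ {a b c d} → a ≤ b → c ≤ d → a ⨾ c ≤ b ⨾ d
  ⨾-mono a≤b c≤d = ≤-trans (⨾-monoˡ a≤b) (⨾-monoʳ c≤d)

  x≤𝟘⇒x≡𝟘 : ∀ {a} → a ≤ 𝟘 → a ≡ 𝟘
  x≤𝟘⇒x≡𝟘 {a} a≤𝟘 = trans (sym (+-identityʳ a)) a≤𝟘

  x≡𝟘⇒x⨾y≡𝟘 : ∀ {a} b → a ≡ 𝟘 → a ⨾ b ≡ 𝟘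
  x≡𝟘⇒x⨾y≡𝟘 b refl = ⨾-zeroˡ b

  y≡𝟘⇒x⨾y≡𝟘 : ∀ a {b} → b ≡ 𝟘 → a ⨾ b ≡ 𝟘
  y≡𝟘⇒x⨾y≡𝟘 a refl = ⨾-zeroʳ a

  x≡𝟘⇒y≡𝟘⇒x+y≡𝟘 : ∀ {a b} → a ≡ 𝟘 → b ≡ 𝟘 → a + b ≡ 𝟘
  x≡𝟘⇒y≡𝟘⇒x+y≡𝟘 refl refl = +-idem 𝟘

  ⨾-swap-middle : ∀ {p q r s} → q ⨾ r ≡ r ⨾ q → (p ⨾ q) ⨾ (r ⨾ s) ≡ (p ⨾ r) ⨾ (q ⨾ s)
  ⨾-swap-middle {p} {q} {r} {s} qr≡rq = begin
    (p ⨾ q) ⨾ (r ⨾ s) ≡⟨ ⨾-assoc p q (r ⨾ s) ⟩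
    p ⨾ (q ⨾ (r ⨾ s)) ≡⟨ cong (p ⨾_) (⨾-assoc q r s) ⟨
    p ⨾ ((q ⨾ r) ⨾ s) ≡⟨ cong (λ z → p ⨾ (z ⨾ s)) qr≡rq ⟩
    p ⨾ ((r ⨾ q) ⨾ s) ≡⟨ cong (p ⨾_) (⨾-assoc r q s) ⟩
    p ⨾ (r ⨾ (q ⨾ s)) ≡⟨ ⨾-assoc p r (q ⨾ s) ⟨
    (p ⨾ r) ⨾ (q ⨾ s) ∎
    where open ≡-Reasoning

  ≤+-annihilated : ∀ {a b c d} → a ≤ b + c → b ⨾ d ≡ 𝟘 → c ⨾ d ≡ 𝟘 → a ⨾ d ≡ 𝟘
  ≤+-annihilated {a} {b} {c} {d} a≤b+c bd≡𝟘 cd≡𝟘 = x≤𝟘⇒x≡𝟘 (begin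
    a ⨾ d           ≤⟨ ⨾-monoˡ a≤b+c ⟩
    (b + c) ⨾ d     ≡⟨ distribʳ b c d ⟩
    b ⨾ d + c ⨾ d   ≡⟨ x≡𝟘⇒y≡𝟘⇒x+y≡𝟘 bd≡𝟘 cd≡𝟘 ⟩
    𝟘               ∎)
    where open ≤-Reasoning

  𝟙≤x* : ∀ a → 𝟙 ≤ a *
  𝟙≤x* a = ≤-trans (x≤x+y _ _) (*-unfoldˡ a)

  x⨾x*≤x* : ∀ a → a ⨾ a * ≤ a *
  x⨾x*≤x* a = ≤-trans (y≤x+y _ _) (*-unfoldˡ a)

  x*⨾x≤x* : ∀ a → a * ⨾ a ≤ a *
  x*⨾x≤x* a = ≤-trans (y≤x+y _ _) (*-unfoldʳ a)

  x≤x* : ∀ a → a ≤ a *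
  x≤x* a = begin
    a         ≡⟨ ⨾-identityʳ a ⟨
    a ⨾ 𝟙     ≤⟨ ⨾-monoʳ (𝟙≤x* a) ⟩
    a ⨾ a *   ≤⟨ x⨾x*≤x* a ⟩
    a *       ∎
    where open ≤-Reasoning

  x*≤𝟙+x⨾x* : ∀ a → a * ≤ 𝟙 + a ⨾ a *
  x*≤𝟙+x⨾x* a = begin
    a *       ≡⟨ ⨾-identityʳ (a *) ⟨
    a * ⨾ 𝟙   ≤⟨ *-inductˡ a 𝟙 (𝟙 + a ⨾ a *) (+-mono ≤-refl (⨾-monoʳ (*-unfoldˡ a))) ⟩
    𝟙 + a ⨾ a * ∎
    where open ≤-Reasoning

  *-simulationʳ : ∀ {x y z} → x ⨾ y ≤ z ⨾ x → x ⨾ y * ≤ z * ⨾ x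
  *-simulationʳ {x} {y} {z} xy≤zx = *-inductʳ y x (z * ⨾ x) (+-lub x≤z*x z*xy≤z*x)
    where
    open ≤-Reasoning
    x≤z*x : x ≤ z * ⨾ x
    x≤z*x = begin
      x         ≡⟨ ⨾-identityˡ x ⟨
      𝟙 ⨾ x     ≤⟨ ⨾-monoˡ (𝟙≤x* z) ⟩
      z * ⨾ x   ∎
    z*xy≤z*x : z * ⨾ x ⨾ y ≤ z * ⨾ x
    z*xy≤z*x = begin
      z * ⨾ x ⨾ y     ≡⟨ ⨾-assoc (z *) x y ⟩
      z * ⨾ (x ⨾ y)   ≤⟨ ⨾-monoʳ xy≤zx ⟩
      z * ⨾ (z ⨾ x)   ≡⟨ ⨾-assoc (z *) z x ⟨
      z * ⨾ z ⨾ x     ≤⟨ ⨾-monoˡ (x*⨾x≤x* z) ⟩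
      z * ⨾ x         ∎

  *-simulationˡ : ∀ {x y z} → y ⨾ x ≤ x ⨾ z → y * ⨾ x ≤ x ⨾ z *
  *-simulationˡ {x} {y} {z} yx≤xz = *-inductˡ y x (x ⨾ z *) (+-lub x≤xz* yxz*≤xz*)
    where
    open ≤-Reasoning
    x≤xz* : x ≤ x ⨾ z *
    x≤xz* = begin
      x         ≡⟨ ⨾-identityʳ x ⟨
      x ⨾ 𝟙     ≤⟨ ⨾-monoʳ (𝟙≤x* z) ⟩
      x ⨾ z *   ∎
    yxz*≤xz* : y ⨾ (x ⨾ z *) ≤ x ⨾ z *
    yxz*≤xz* = begin
      y ⨾ (x ⨾ z *)   ≡⟨ ⨾-assoc y x (z *) ⟨
      y ⨾ x ⨾ z *     ≤⟨ ⨾-monoˡ yx≤xz ⟩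
      x ⨾ z ⨾ z *     ≡⟨ ⨾-assoc x z (z *) ⟩
      x ⨾ (z ⨾ z *)   ≤⟨ ⨾-monoʳ (x⨾x*≤x* z) ⟩
      x ⨾ z *         ∎

  x*⨾y*≤[x⨾y]*⨾[x*+y*] : ∀ {a b} → a ⨾ b ≡ b ⨾ a → a * ⨾ b * ≤ (a ⨾ b) * ⨾ (a * + b *)
  x*⨾y*≤[x⨾y]*⨾[x*+y*] {a} {b} ab≡ba = *-inductˡ a (b *) (s ⨾ (a * + b *))
    (+-lub b*≤ a-step)
    where
    open ≤-Reasoning
    s = (a ⨾ b) *
    b*≤ : b * ≤ s ⨾ (a * + b *)
    b*≤ = begin
      b *               ≡⟨ ⨾-identityˡ (b *) ⟨
      𝟙 ⨾ b *           ≤⟨ ⨾-mono (𝟙≤x* (a ⨾ b)) (y≤x+y (a *) (b *)) ⟩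
      s ⨾ (a * + b *)   ∎
    a⨾b*≤ : a ⨾ b * ≤ a * + a ⨾ b ⨾ b *
    a⨾b*≤ = begin
      a ⨾ b *                 ≤⟨ ⨾-monoʳ (x*≤𝟙+x⨾x* b) ⟩
      a ⨾ (𝟙 + b ⨾ b *)       ≡⟨ distribˡ a 𝟙 (b ⨾ b *) ⟩
      a ⨾ 𝟙 + a ⨾ (b ⨾ b *)   ≡⟨ cong₂ _+_ (⨾-identityʳ a) (sym (⨾-assoc a b (b *))) ⟩
      a + a ⨾ b ⨾ b *         ≤⟨ +-mono (x≤x* a) ≤-refl ⟩
      a * + a ⨾ b ⨾ b *       ∎
    a-commutes : a ⨾ (a ⨾ b) ≤ (a ⨾ b) ⨾ a
    a-commutes = ≤-reflexive (begin-equality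
      a ⨾ (a ⨾ b)   ≡⟨ cong (a ⨾_) ab≡ba ⟩
      a ⨾ (b ⨾ a)   ≡⟨ ⨾-assoc a b a ⟨
      a ⨾ b ⨾ a     ∎)
    a-step : a ⨾ (s ⨾ (a * + b *)) ≤ s ⨾ (a * + b *)
    a-step = begin
      a ⨾ (s ⨾ (a * + b *))             ≡⟨ ⨾-assoc a s _ ⟨
      a ⨾ s ⨾ (a * + b *)               ≤⟨ ⨾-monoˡ (*-simulationʳ a-commutes) ⟩
      s ⨾ a ⨾ (a * + b *)               ≡⟨ ⨾-assoc s a _ ⟩
      s ⨾ (a ⨾ (a * + b *))             ≡⟨ cong (s ⨾_) (distribˡ a (a *) (b *)) ⟩
      s ⨾ (a ⨾ a * + a ⨾ b *)           ≤⟨ ⨾-monoʳ (+-lub (≤-trans (x⨾x*≤x* a) (x≤x+y _ _)) a⨾b*≤) ⟩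
      s ⨾ (a * + a ⨾ b ⨾ b *)           ≡⟨ distribˡ s (a *) _ ⟩
      s ⨾ a * + s ⨾ (a ⨾ b ⨾ b *)       ≡⟨ cong (s ⨾ a * +_) (⨾-assoc s (a ⨾ b) (b *)) ⟨
      s ⨾ a * + s ⨾ (a ⨾ b) ⨾ b *       ≤⟨ +-mono ≤-refl (⨾-monoˡ (x*⨾x≤x* (a ⨾ b))) ⟩
      s ⨾ a * + s ⨾ b *                 ≡⟨ distribˡ s (a *) (b *) ⟨
      s ⨾ (a * + b *)                   ∎

  ¬x⨾x≡𝟘 : ∀ p → ι (¬ p) ⨾ ι p ≡ 𝟘
  ¬x⨾x≡𝟘 p = trans (test-comm (¬ p) p) (test-excl p)

  test≤𝟙 : ∀ p → ι p ≤ 𝟙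
  test≤𝟙 p = begin
    ι p                     ≤⟨ x≤x+y (ι p) (ι (¬ p)) ⟩
    ι p + ι (¬ p)           ≡⟨ test-compl p ⟩
    𝟙                       ∎
    where open ≤-Reasoning

  ¬-antitone : ∀ {p q} → ι p ≤ ι q → ι (¬ q) ≤ ι (¬ p)
  ¬-antitone {p} {q} p≤q = begin
    ι (¬ q)                                 ≡⟨ ⨾-identityʳ (ι (¬ q)) ⟨
    ι (¬ q) ⨾ 𝟙                             ≡⟨ cong (ι (¬ q) ⨾_) (test-compl p) ⟨
    ι (¬ q) ⨾ (ι p + ι (¬ p))               ≡⟨ distribˡ (ι (¬ q)) (ι p) (ι (¬ p)) ⟩
    ι (¬ q) ⨾ ι p + ι (¬ q) ⨾ ι (¬ p)       ≤⟨ +-mono (⨾-monoʳ p≤q) (⨾-monoˡ (test≤𝟙 (¬ q))) ⟩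
    ι (¬ q) ⨾ ι q + 𝟙 ⨾ ι (¬ p)             ≡⟨ cong₂ _+_ (¬x⨾x≡𝟘 q) (⨾-identityˡ (ι (¬ p))) ⟩
    𝟘 + ι (¬ p)                             ≡⟨ +-identityˡ (ι (¬ p)) ⟩
    ι (¬ p)                                 ∎
    where open ≤-Reasoning

  t⨾-disjointˡ : ∀ {p q p′ q′} → ι p ⨾ ι p′ ≡ 𝟘 → ι (p t⨾ q) ⨾ ι (p′ t⨾ q′) ≡ 𝟘
  t⨾-disjointˡ {p} {q} {p′} {q′} pp′≡𝟘 = begin
    ι (p t⨾ q) ⨾ ι (p′ t⨾ q′)       ≡⟨ cong₂ _⨾_ (ι-⨾ p q) (ι-⨾ p′ q′) ⟩
    (ι p ⨾ ι q) ⨾ (ι p′ ⨾ ι q′)     ≡⟨ ⨾-swap-middle (test-comm q p′) ⟩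
    (ι p ⨾ ι p′) ⨾ (ι q ⨾ ι q′)     ≡⟨ x≡𝟘⇒x⨾y≡𝟘 _ pp′≡𝟘 ⟩
    𝟘                               ∎
    where open ≡-Reasoning

  t⨾-disjointʳ : ∀ {p q p′ q′} → ι q ⨾ ι q′ ≡ 𝟘 → ι (p t⨾ q) ⨾ ι (p′ t⨾ q′) ≡ 𝟘
  t⨾-disjointʳ {p} {q} {p′} {q′} qq′≡𝟘 = begin
    ι (p t⨾ q) ⨾ ι (p′ t⨾ q′)       ≡⟨ cong₂ _⨾_ (ι-⨾ p q) (ι-⨾ p′ q′) ⟩
    (ι p ⨾ ι q) ⨾ (ι p′ ⨾ ι q′)     ≡⟨ ⨾-swap-middle (test-comm q p′) ⟩
    (ι p ⨾ ι p′) ⨾ (ι q ⨾ ι q′)     ≡⟨ y≡𝟘⇒x⨾y≡𝟘 _ qq′≡𝟘 ⟩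
    𝟘                               ∎
    where open ≡-Reasoning

  guarded-step-blocked : ∀ {t u n c} → c ⨾ ι n ≡ ι n ⨾ c → ι t ⨾ (ι u ⨾ ι n) ≡ 𝟘 →
                       ι t ⨾ (ι u ⨾ c) ⨾ ι n ≡ 𝟘
  guarded-step-blocked {t} {u} {n} {c} cn≡nc tun≡𝟘 = begin
    ι t ⨾ (ι u ⨾ c) ⨾ ι n       ≡⟨ ⨾-assoc (ι t) (ι u ⨾ c) (ι n) ⟩
    ι t ⨾ (ι u ⨾ c ⨾ ι n)       ≡⟨ cong (ι t ⨾_) (⨾-assoc (ι u) c (ι n)) ⟩
    ι t ⨾ (ι u ⨾ (c ⨾ ι n))     ≡⟨ cong (λ z → ι t ⨾ (ι u ⨾ z)) cn≡nc ⟩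
    ι t ⨾ (ι u ⨾ (ι n ⨾ c))     ≡⟨ cong (ι t ⨾_) (⨾-assoc (ι u) (ι n) c) ⟨
    ι t ⨾ (ι u ⨾ ι n ⨾ c)       ≡⟨ ⨾-assoc (ι t) (ι u ⨾ ι n) c ⟨
    ι t ⨾ (ι u ⨾ ι n) ⨾ c       ≡⟨ x≡𝟘⇒x⨾y≡𝟘 c tun≡𝟘 ⟩
    𝟘                           ∎
    where open ≡-Reasoning

  Hoare : Test → Carrier → Test → Set ℓ
  Hoare p x q = ι p ⨾ x ⨾ ι (¬ q) ≡ 𝟘

  p⨾x≤y⨾q⇒hoare : ∀ {p x y q} → ι p ⨾ x ≤ y ⨾ ι q → Hoare p x q
  p⨾x≤y⨾q⇒hoare {p} {x} {y} {q} px≤yq = x≤𝟘⇒x≡𝟘 (begin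
    ι p ⨾ x ⨾ ι (¬ q)       ≤⟨ ⨾-monoˡ px≤yq ⟩
    y ⨾ ι q ⨾ ι (¬ q)       ≡⟨ ⨾-assoc y (ι q) (ι (¬ q)) ⟩
    y ⨾ (ι q ⨾ ι (¬ q))     ≡⟨ y≡𝟘⇒x⨾y≡𝟘 y (test-excl q) ⟩
    𝟘                       ∎)
    where open ≤-Reasoning

  hoare-mono : ∀ {p q r s x y} → ι r ≤ ι p → y ≤ x → ι q ≤ ι s →
               Hoare p x q → Hoare r y s
  hoare-mono {p} {q} {r} {s} {x} {y} r≤p y≤x q≤s pxq = x≤𝟘⇒x≡𝟘 (begin
    ι r ⨾ y ⨾ ι (¬ s)   ≤⟨ ⨾-mono (⨾-mono r≤p y≤x) (¬-antitone q≤s) ⟩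
    ι p ⨾ x ⨾ ι (¬ q)   ≡⟨ pxq ⟩
    𝟘                   ∎)
    where open ≤-Reasoning

  hoare⇒p⨾x≡p⨾x⨾q : ∀ {p x q} → Hoare p x q → ι p ⨾ x ≡ ι p ⨾ x ⨾ ι q
  hoare⇒p⨾x≡p⨾x⨾q {p} {x} {q} pxq = begin
    ι p ⨾ x                                 ≡⟨ ⨾-identityʳ (ι p ⨾ x) ⟨
    ι p ⨾ x ⨾ 𝟙                             ≡⟨ cong (ι p ⨾ x ⨾_) (test-compl q) ⟨
    ι p ⨾ x ⨾ (ι q + ι (¬ q))               ≡⟨ distribˡ (ι p ⨾ x) (ι q) (ι (¬ q)) ⟩
    ι p ⨾ x ⨾ ι q + ι p ⨾ x ⨾ ι (¬ q)       ≡⟨ cong (ι p ⨾ x ⨾ ι q +_) pxq ⟩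
    ι p ⨾ x ⨾ ι q + 𝟘                       ≡⟨ +-identityʳ (ι p ⨾ x ⨾ ι q) ⟩
    ι p ⨾ x ⨾ ι q                           ∎
    where open ≡-Reasoning

  hoare-seq : ∀ {p r q x y} → Hoare p x r → Hoare r y q → Hoare p (x ⨾ y) q
  hoare-seq {p} {r} {q} {x} {y} pxr ryq = begin
    ι p ⨾ (x ⨾ y) ⨾ ι (¬ q)           ≡⟨ cong (_⨾ ι (¬ q)) (⨾-assoc (ι p) x y) ⟨
    ι p ⨾ x ⨾ y ⨾ ι (¬ q)             ≡⟨ cong (λ z → z ⨾ y ⨾ ι (¬ q)) (hoare⇒p⨾x≡p⨾x⨾q pxr) ⟩
    ι p ⨾ x ⨾ ι r ⨾ y ⨾ ι (¬ q)       ≡⟨ cong (_⨾ ι (¬ q)) (⨾-assoc (ι p ⨾ x) (ι r) y) ⟩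
    ι p ⨾ x ⨾ (ι r ⨾ y) ⨾ ι (¬ q)     ≡⟨ ⨾-assoc (ι p ⨾ x) (ι r ⨾ y) (ι (¬ q)) ⟩
    ι p ⨾ x ⨾ (ι r ⨾ y ⨾ ι (¬ q))     ≡⟨ y≡𝟘⇒x⨾y≡𝟘 (ι p ⨾ x) ryq ⟩
    𝟘                                 ∎
    where open ≡-Reasoning

  hoare-+ : ∀ {p q x y} → Hoare p x q → Hoare p y q → Hoare p (x + y) q
  hoare-+ {p} {q} {x} {y} pxq pyq = begin
    ι p ⨾ (x + y) ⨾ ι (¬ q)                   ≡⟨ cong (_⨾ ι (¬ q)) (distribˡ (ι p) x y) ⟩
    (ι p ⨾ x + ι p ⨾ y) ⨾ ι (¬ q)             ≡⟨ distribʳ (ι p ⨾ x) (ι p ⨾ y) (ι (¬ q)) ⟩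
    ι p ⨾ x ⨾ ι (¬ q) + ι p ⨾ y ⨾ ι (¬ q)     ≡⟨ x≡𝟘⇒y≡𝟘⇒x+y≡𝟘 pxq pyq ⟩
    𝟘                                         ∎
    where open ≡-Reasoning

  hoare-t+ : ∀ {p r q x} → Hoare p x q → Hoare r x q → Hoare (p t+ r) x q
  hoare-t+ {p} {r} {q} {x} pxq rxq = begin
    ι (p t+ r) ⨾ x ⨾ ι (¬ q)                  ≡⟨ cong (λ z → z ⨾ x ⨾ ι (¬ q)) (ι-+ p r) ⟩
    (ι p + ι r) ⨾ x ⨾ ι (¬ q)                 ≡⟨ cong (_⨾ ι (¬ q)) (distribʳ (ι p) (ι r) x) ⟩
    (ι p ⨾ x + ι r ⨾ x) ⨾ ι (¬ q)             ≡⟨ distribʳ (ι p ⨾ x) (ι r ⨾ x) (ι (¬ q)) ⟩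
    ι p ⨾ x ⨾ ι (¬ q) + ι r ⨾ x ⨾ ι (¬ q)     ≡⟨ x≡𝟘⇒y≡𝟘⇒x+y≡𝟘 pxq rxq ⟩
    𝟘                                         ∎
    where open ≡-Reasoning

  hoare-* : ∀ {p x} → Hoare p x p → Hoare p (x *) p
  hoare-* {p} {x} pxp = p⨾x≤y⨾q⇒hoare (*-simulationʳ px≤xp)
    where
    open ≤-Reasoning
    px≤xp : ι p ⨾ x ≤ x ⨾ ι p
    px≤xp = begin
      ι p ⨾ x             ≡⟨ hoare⇒p⨾x≡p⨾x⨾q pxp ⟩
      ι p ⨾ x ⨾ ι p       ≡⟨ ⨾-assoc (ι p) x (ι p) ⟩
      ι p ⨾ (x ⨾ ι p)     ≤⟨ ⨾-monoˡ (test≤𝟙 p) ⟩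
      𝟙 ⨾ (x ⨾ ι p)       ≡⟨ ⨾-identityˡ (x ⨾ ι p) ⟩
      x ⨾ ι p             ∎

  hoare-guard : ∀ {p g q x} → Hoare (p t⨾ g) x q → Hoare p (ι g ⨾ x) q
  hoare-guard {p} {g} {q} {x} = subst (_≡ 𝟘) (cong (_⨾ ι (¬ q)) (begin
    ι (p t⨾ g) ⨾ x      ≡⟨ cong (_⨾ x) (ι-⨾ p g) ⟩
    ι p ⨾ ι g ⨾ x       ≡⟨ ⨾-assoc (ι p) (ι g) x ⟩
    ι p ⨾ (ι g ⨾ x)     ∎))
    where open ≡-Reasoning

  hoare-unreachable : ∀ {p g q x} → ι p ⨾ ι g ≡ 𝟘 → Hoare p (ι g ⨾ x) q
  hoare-unreachable {p} {g} {q} {x} pg≡𝟘 = begin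
    ι p ⨾ (ι g ⨾ x) ⨾ ι (¬ q)     ≡⟨ cong (_⨾ ι (¬ q)) (⨾-assoc (ι p) (ι g) x) ⟨
    ι p ⨾ ι g ⨾ x ⨾ ι (¬ q)       ≡⟨ x≡𝟘⇒x⨾y≡𝟘 (ι (¬ q)) (x≡𝟘⇒x⨾y≡𝟘 x pg≡𝟘) ⟩
    𝟘                             ∎
    where open ≡-Reasoning

  *-exit : ∀ {t n a} → a ⨾ ι n ≡ ι n ⨾ a → ι t ⨾ a ⨾ ι n ≡ 𝟘 → ι t ⨾ a * ⨾ ι n ≤ ι t ⨾ ι n
  *-exit {t} {n} {a} an≡na tan≡𝟘 = begin
    ι t ⨾ a * ⨾ ι n                         ≤⟨ ⨾-monoˡ (⨾-monoʳ (x*≤𝟙+x⨾x* a)) ⟩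
    ι t ⨾ (𝟙 + a ⨾ a *) ⨾ ι n               ≡⟨ cong (_⨾ ι n) (distribˡ (ι t) 𝟙 (a ⨾ a *)) ⟩
    (ι t ⨾ 𝟙 + ι t ⨾ (a ⨾ a *)) ⨾ ι n       ≡⟨ distribʳ (ι t ⨾ 𝟙) (ι t ⨾ (a ⨾ a *)) (ι n) ⟩
    ι t ⨾ 𝟙 ⨾ ι n + ι t ⨾ (a ⨾ a *) ⨾ ι n   ≤⟨ +-mono (≤-reflexive (cong (_⨾ ι n) (⨾-identityʳ (ι t))))
                                                      (≤-reflexive (trans ta⁺n≡ta[a*n] (x≤𝟘⇒x≡𝟘 ta[a*n]≤𝟘))) ⟩
    ι t ⨾ ι n + 𝟘                           ≡⟨ +-identityʳ (ι t ⨾ ι n) ⟩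
    ι t ⨾ ι n                               ∎
    where
    open ≤-Reasoning
    ta⁺n≡ta[a*n] : ι t ⨾ (a ⨾ a *) ⨾ ι n ≡ ι t ⨾ a ⨾ (a * ⨾ ι n)
    ta⁺n≡ta[a*n] = trans (cong (_⨾ ι n) (sym (⨾-assoc (ι t) a (a *)))) (⨾-assoc (ι t ⨾ a) (a *) (ι n))
    ta[a*n]≤𝟘 : ι t ⨾ a ⨾ (a * ⨾ ι n) ≤ 𝟘
    ta[a*n]≤𝟘 = begin
      ι t ⨾ a ⨾ (a * ⨾ ι n)     ≤⟨ ⨾-monoʳ (*-simulationˡ (≤-reflexive an≡na)) ⟩
      ι t ⨾ a ⨾ (ι n ⨾ a *)     ≡⟨ ⨾-assoc (ι t ⨾ a) (ι n) (a *) ⟨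
      ι t ⨾ a ⨾ ι n ⨾ a *       ≡⟨ x≡𝟘⇒x⨾y≡𝟘 (a *) tan≡𝟘 ⟩
      𝟘                         ∎

  hoare-*-exits : ∀ {t m n a b} →
    a ⨾ ι n ≡ ι n ⨾ a → b ⨾ ι m ≡ ι m ⨾ b → ι t ⨾ a ⨾ ι n ≡ 𝟘 → ι t ⨾ b ⨾ ι m ≡ 𝟘 →
    Hoare t ((a * + b *) ⨾ ι (m t⨾ n)) (t t⨾ (m t⨾ n))
  hoare-*-exits {t} {m} {n} {a} {b} an≡na bm≡mb tan≡𝟘 tbm≡𝟘 = p⨾x≤y⨾q⇒hoare (begin
    ι t ⨾ ((a * + b *) ⨾ ι (m t⨾ n))                        ≡⟨ cong (ι t ⨾_) (distribʳ (a *) (b *) _) ⟩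
    ι t ⨾ (a * ⨾ ι (m t⨾ n) + b * ⨾ ι (m t⨾ n))             ≡⟨ distribˡ (ι t) _ _ ⟩
    ι t ⨾ (a * ⨾ ι (m t⨾ n)) + ι t ⨾ (b * ⨾ ι (m t⨾ n))     ≤⟨ +-lub a-exit b-exit ⟩
    ι t ⨾ ι (m t⨾ n)                                        ≡⟨ ι-⨾ t (m t⨾ n) ⟨
    ι (t t⨾ (m t⨾ n))                                       ≡⟨ ⨾-identityˡ _ ⟨
    𝟙 ⨾ ι (t t⨾ (m t⨾ n))                                   ∎)
    where
    open ≤-Reasoning
    exit-before : ∀ {x k l} → ι t ⨾ x ⨾ ι k ≤ ι t ⨾ ι k →
                  ι t ⨾ (x ⨾ (ι k ⨾ ι l)) ≤ ι t ⨾ (ι k ⨾ ι l)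
    exit-before {x} {k} {l} txk≤tk = begin
      ι t ⨾ (x ⨾ (ι k ⨾ ι l))     ≡⟨ cong (ι t ⨾_) (⨾-assoc x (ι k) (ι l)) ⟨
      ι t ⨾ (x ⨾ ι k ⨾ ι l)       ≡⟨ ⨾-assoc (ι t) (x ⨾ ι k) (ι l) ⟨
      ι t ⨾ (x ⨾ ι k) ⨾ ι l       ≡⟨ cong (_⨾ ι l) (⨾-assoc (ι t) x (ι k)) ⟨
      ι t ⨾ x ⨾ ι k ⨾ ι l         ≤⟨ ⨾-monoˡ txk≤tk ⟩
      ι t ⨾ ι k ⨾ ι l             ≡⟨ ⨾-assoc (ι t) (ι k) (ι l) ⟩
      ι t ⨾ (ι k ⨾ ι l)           ∎
    a-exit : ι t ⨾ (a * ⨾ ι (m t⨾ n)) ≤ ι t ⨾ ι (m t⨾ n)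
    a-exit = subst (λ z → ι t ⨾ (a * ⨾ z) ≤ ι t ⨾ z) (sym (trans (ι-⨾ m n) (test-comm m n)))
                   (exit-before (*-exit an≡na tan≡𝟘))
    b-exit : ι t ⨾ (b * ⨾ ι (m t⨾ n)) ≤ ι t ⨾ ι (m t⨾ n)
    b-exit = subst (λ z → ι t ⨾ (b * ⨾ z) ≤ ι t ⨾ z) (sym (ι-⨾ m n))
                   (exit-before (*-exit bm≡mb tbm≡𝟘))

  -- a and b are two loop bodies run side by side, with exit tests m and n.  From
  -- the invariant t neither body can run once the other side has exited, so
  -- a* ⨾ b* behaves like (a ⨾ b)* followed by the exits.
  hoare-*-lockstep : ∀ {t m n a b} →
    a ⨾ b ≡ b ⨾ a → a ⨾ ι n ≡ ι n ⨾ a → b ⨾ ι m ≡ ι m ⨾ b →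
    ι t ⨾ a ⨾ ι n ≡ 𝟘 → ι t ⨾ b ⨾ ι m ≡ 𝟘 → Hoare t (a ⨾ b) t →
    Hoare t (a * ⨾ b * ⨾ ι (m t⨾ n)) (t t⨾ (m t⨾ n))
  hoare-*-lockstep {t} {m} {n} {a} {b} ab≡ba an≡na bm≡mb tan≡𝟘 tbm≡𝟘 tabt =
    hoare-mono ≤-refl lockstep ≤-refl
      (hoare-seq (hoare-* tabt) (hoare-*-exits an≡na bm≡mb tan≡𝟘 tbm≡𝟘))
    where
    open ≤-Reasoning
    lockstep : a * ⨾ b * ⨾ ι (m t⨾ n) ≤ (a ⨾ b) * ⨾ ((a * + b *) ⨾ ι (m t⨾ n))
    lockstep = begin
      a * ⨾ b * ⨾ ι (m t⨾ n)                    ≤⟨ ⨾-monoˡ (x*⨾y*≤[x⨾y]*⨾[x*+y*] ab≡ba) ⟩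
      (a ⨾ b) * ⨾ (a * + b *) ⨾ ι (m t⨾ n)      ≡⟨ ⨾-assoc ((a ⨾ b) *) (a * + b *) (ι (m t⨾ n)) ⟩
      (a ⨾ b) * ⨾ ((a * + b *) ⨾ ι (m t⨾ n))    ∎

module KATHomProperties {ℓ₁ ℓ₂} {A : KAT ℓ₁} {B : KAT ℓ₂} (H : KATHom A B) where
  open KATHom H
  private
    module A = KAT A
    module B = KAT B

  f-ι : ∀ e → f (A.ι e) ≡ B.ι (fT e)
  f-ι e = sym (fT-ι e)

  f-ι⨾ : ∀ e x → f (A.ι e A.⨾ x) ≡ B.ι (fT e) B.⨾ f x
  f-ι⨾ e x = trans (f-⨾ (A.ι e) x) (cong (B._⨾ f x) (f-ι e))

  fT-excl : ∀ e → B.ι (fT e) B.⨾ B.ι (fT (A.¬ e)) ≡ B.𝟘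
  fT-excl e = begin
    B.ι (fT e) B.⨾ B.ι (fT (A.¬ e))   ≡⟨ cong₂ B._⨾_ (fT-ι e) (fT-ι (A.¬ e)) ⟩
    f (A.ι e) B.⨾ f (A.ι (A.¬ e))     ≡⟨ f-⨾ (A.ι e) (A.ι (A.¬ e)) ⟨
    f (A.ι e A.⨾ A.ι (A.¬ e))         ≡⟨ cong f (A.test-excl e) ⟩
    f A.𝟘                             ≡⟨ f-𝟘 ⟩
    B.𝟘                               ∎
    where open ≡-Reasoning

  fT-excl′ : ∀ e → B.ι (fT (A.¬ e)) B.⨾ B.ι (fT e) ≡ B.𝟘
  fT-excl′ e = trans (B.test-comm (fT (A.¬ e)) (fT e)) (fT-excl e)

module BiKATProperties {ℓ₁ ℓ₂} {𝔸 : KAT ℓ₁} (𝔹 : BiKAT ℓ₂ 𝔸) where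
  open BiKAT 𝔹
  open KAT Ä
  open KATProperties Ä
  open KATHom L using () renaming (f to ⟨_]; fT to ⟨_]ᵇ)
  open KATHom R using () renaming (f to [_⟩; fT to [_⟩ᵇ)
  private
    module A = KAT 𝔸
    module L = KATHomProperties L
    module R = KATHomProperties R

  ⟨ι∣ι⟩ : ∀ e e′ → ⟨ A.ι e ∣ A.ι e′ ⟩ ≡ ι ⟨ e ∣ e′ ⟩ᵇ
  ⟨ι∣ι⟩ e e′ = trans (cong₂ _⨾_ (L.f-ι e) (R.f-ι e′)) (sym (ι-⨾ ⟨ e ]ᵇ [ e′ ⟩ᵇ))

  ⟨⨾∣⨾⟩ : ∀ x y x′ y′ → ⟨ x A.⨾ y ∣ x′ A.⨾ y′ ⟩ ≡ ⟨ x ∣ x′ ⟩ ⨾ ⟨ y ∣ y′ ⟩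
  ⟨⨾∣⨾⟩ x y x′ y′ = trans (cong₂ _⨾_ (KATHom.f-⨾ L x y) (KATHom.f-⨾ R x′ y′))
                          (⨾-swap-middle (LR-comm y x′))

  ⟨ι⨾∣ι⨾⟩ : ∀ e e′ x x′ → ⟨ A.ι e A.⨾ x ∣ A.ι e′ A.⨾ x′ ⟩ ≡ ι ⟨ e ∣ e′ ⟩ᵇ ⨾ ⟨ x ∣ x′ ⟩
  ⟨ι⨾∣ι⨾⟩ e e′ x x′ = trans (⟨⨾∣⨾⟩ (A.ι e) x (A.ι e′) x′) (cong (_⨾ ⟨ x ∣ x′ ⟩) (⟨ι∣ι⟩ e e′))

  ⟨+∣+⟩ : ∀ x y x′ y′ →
          ⟨ x A.+ y ∣ x′ A.+ y′ ⟩ ≡ (⟨ x ∣ x′ ⟩ + ⟨ x ∣ y′ ⟩) + (⟨ y ∣ x′ ⟩ + ⟨ y ∣ y′ ⟩)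
  ⟨+∣+⟩ x y x′ y′ = begin
    ⟨ x A.+ y ∣ x′ A.+ y′ ⟩                               ≡⟨ cong₂ _⨾_ (KATHom.f-+ L x y) (KATHom.f-+ R x′ y′) ⟩
    (⟨ x ] + ⟨ y ]) ⨾ ([ x′ ⟩ + [ y′ ⟩)                   ≡⟨ distribʳ ⟨ x ] ⟨ y ] _ ⟩
    ⟨ x ] ⨾ ([ x′ ⟩ + [ y′ ⟩) + ⟨ y ] ⨾ ([ x′ ⟩ + [ y′ ⟩) ≡⟨ cong₂ _+_ (distribˡ ⟨ x ] _ _) (distribˡ ⟨ y ] _ _) ⟩
    (⟨ x ∣ x′ ⟩ + ⟨ x ∣ y′ ⟩) + (⟨ y ∣ x′ ⟩ + ⟨ y ∣ y′ ⟩) ∎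
    where open ≡-Reasoning

  ⟨if∣if⟩ : ∀ e e′ c c′ d d′ →
    ⟨ A.ι e A.⨾ c A.+ A.ι (A.¬ e) A.⨾ d ∣ A.ι e′ A.⨾ c′ A.+ A.ι (A.¬ e′) A.⨾ d′ ⟩ ≡
    (ι ⟨ e ∣ e′ ⟩ᵇ ⨾ ⟨ c ∣ c′ ⟩ + ι ⟨ e ∣ A.¬ e′ ⟩ᵇ ⨾ ⟨ c ∣ d′ ⟩) +
    (ι ⟨ A.¬ e ∣ e′ ⟩ᵇ ⨾ ⟨ d ∣ c′ ⟩ + ι ⟨ A.¬ e ∣ A.¬ e′ ⟩ᵇ ⨾ ⟨ d ∣ d′ ⟩)
  ⟨if∣if⟩ e e′ c c′ d d′ = trans (⟨+∣+⟩ _ _ _ _)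
    (cong₂ _+_ (cong₂ _+_ (⟨ι⨾∣ι⨾⟩ e e′ c c′) (⟨ι⨾∣ι⨾⟩ e (A.¬ e′) c d′))
               (cong₂ _+_ (⟨ι⨾∣ι⨾⟩ (A.¬ e) e′ d c′) (⟨ι⨾∣ι⨾⟩ (A.¬ e) (A.¬ e′) d d′)))

  ⟨while∣while⟩ : ∀ e e′ c c′ →
    ⟨ (A.ι e A.⨾ c) A.* A.⨾ A.ι (A.¬ e) ∣ (A.ι e′ A.⨾ c′) A.* A.⨾ A.ι (A.¬ e′) ⟩ ≡
    ⟨ A.ι e A.⨾ c ] * ⨾ [ A.ι e′ A.⨾ c′ ⟩ * ⨾ ι ⟨ A.¬ e ∣ A.¬ e′ ⟩ᵇ
  ⟨while∣while⟩ e e′ c c′ = trans (⟨⨾∣⨾⟩ _ _ _ _)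
    (cong₂ _⨾_ (cong₂ _⨾_ (KATHom.f-* L _) (KATHom.f-* R _)) (⟨ι∣ι⟩ (A.¬ e) (A.¬ e′)))

  ⟨]⨾[]ᵇ-comm : ∀ x e → ⟨ x ] ⨾ ι [ e ⟩ᵇ ≡ ι [ e ⟩ᵇ ⨾ ⟨ x ]
  ⟨]⨾[]ᵇ-comm x e = subst (λ z → ⟨ x ] ⨾ z ≡ z ⨾ ⟨ x ]) (R.f-ι e) (LR-comm x (A.ι e))

  [⟩⨾⟨]ᵇ-comm : ∀ y e → [ y ⟩ ⨾ ι ⟨ e ]ᵇ ≡ ι ⟨ e ]ᵇ ⨾ [ y ⟩
  [⟩⨾⟨]ᵇ-comm y e = subst (λ z → [ y ⟩ ⨾ z ≡ z ⨾ [ y ⟩) (L.f-ι e) (sym (LR-comm (A.ι e) y))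

  mixed-guards-unreachable : ∀ {P e e′} → ι P ≤ Rules.guardCover 𝔸 𝔹 e e′ →
    ι P ⨾ ι ⟨ e ∣ A.¬ e′ ⟩ᵇ ≡ 𝟘 × ι P ⨾ ι ⟨ A.¬ e ∣ e′ ⟩ᵇ ≡ 𝟘
  mixed-guards-unreachable {e = e} {e′} cover =
    ≤+-annihilated cover (t⨾-disjointʳ (R.fT-excl e′)) (t⨾-disjointˡ (L.fT-excl′ e)) ,
    ≤+-annihilated cover (t⨾-disjointˡ (L.fT-excl e)) (t⨾-disjointʳ (R.fT-excl′ e′))

  dSeq : Rules.dSeq 𝔸 𝔹
  dSeq c c′ d d′ P Q R cPR dRQ =
    subst (λ x → Hoare P x Q) (sym (⟨⨾∣⨾⟩ c d c′ d′)) (hoare-seq cPR dRQ)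

  dIf : Rules.dIf 𝔸 𝔹
  dIf c c′ d d′ e e′ P Q cover cPQ dPQ =
    subst (λ x → Hoare P x Q) (sym (⟨if∣if⟩ e e′ c c′ d d′))
      (hoare-+ (hoare-+ (hoare-guard cPQ) (hoare-unreachable (proj₁ mixed)))
               (hoare-+ (hoare-unreachable (proj₂ mixed)) (hoare-guard dPQ)))
    where
    mixed : ι P ⨾ ι ⟨ e ∣ A.¬ e′ ⟩ᵇ ≡ 𝟘 × ι P ⨾ ι ⟨ A.¬ e ∣ e′ ⟩ᵇ ≡ 𝟘
    mixed = mixed-guards-unreachable cover

  dWh : Rules.dWh 𝔸 𝔹
  dWh c c′ e e′ P cover cPP =
    subst (λ x → Hoare P x (P t⨾ ⟨ A.¬ e ∣ A.¬ e′ ⟩ᵇ)) (sym (⟨while∣while⟩ e e′ c c′))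
      (hoare-*-lockstep (LR-comm _ _) (⟨]⨾[]ᵇ-comm _ (A.¬ e′)) ([⟩⨾⟨]ᵇ-comm _ (A.¬ e))
        left-blocked right-blocked body)
    where
    mixed : ι P ⨾ ι ⟨ e ∣ A.¬ e′ ⟩ᵇ ≡ 𝟘 × ι P ⨾ ι ⟨ A.¬ e ∣ e′ ⟩ᵇ ≡ 𝟘
    mixed = mixed-guards-unreachable cover
    left-blocked : ι P ⨾ ⟨ A.ι e A.⨾ c ] ⨾ ι [ A.¬ e′ ⟩ᵇ ≡ 𝟘
    left-blocked = trans (cong (λ z → ι P ⨾ z ⨾ ι [ A.¬ e′ ⟩ᵇ) (L.f-ι⨾ e c))
      (guarded-step-blocked (⟨]⨾[]ᵇ-comm c (A.¬ e′))
        (trans (cong (ι P ⨾_) (sym (ι-⨾ _ _))) (proj₁ mixed)))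
    right-blocked : ι P ⨾ [ A.ι e′ A.⨾ c′ ⟩ ⨾ ι ⟨ A.¬ e ]ᵇ ≡ 𝟘
    right-blocked = trans (cong (λ z → ι P ⨾ z ⨾ ι ⟨ A.¬ e ]ᵇ) (R.f-ι⨾ e′ c′))
      (guarded-step-blocked ([⟩⨾⟨]ᵇ-comm c′ (A.¬ e))
        (trans (cong (ι P ⨾_) (trans (test-comm _ _) (sym (ι-⨾ _ _)))) (proj₂ mixed)))
    body : Hoare P (⟨ A.ι e A.⨾ c ] ⨾ [ A.ι e′ A.⨾ c′ ⟩) P
    body = subst (λ x → Hoare P x P) (sym (⟨ι⨾∣ι⨾⟩ e e′ c c′)) (hoare-guard cPP)

  rDisj : Rules.rDisj 𝔸 𝔹
  rDisj _ _ _ _ _ = hoare-t+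

  SeqSk : Rules.SeqSk 𝔸 𝔹
  SeqSk c d P Q R cPR dRQ = subst (λ x → Hoare P ⟨ c A.⨾ d ∣ x ⟩ Q) (A.⨾-identityˡ A.𝟙)
                                  (dSeq c A.𝟙 d A.𝟙 P Q R cPR dRQ)

  rConseq : Rules.rConseq 𝔸 𝔹
  rConseq _ _ _ _ _ _ R≤P cPQ Q≤S = hoare-mono R≤P ≤-refl Q≤S cPQ

theorem6p1 : ∀ {ℓ₁ ℓ₂} (𝔸 : KAT ℓ₁) (𝔹 : BiKAT ℓ₂ 𝔸) →
    Rules.dSeq 𝔸 𝔹 × Rules.dIf 𝔸 𝔹 × Rules.dWh 𝔸 𝔹 ×
    Rules.rDisj 𝔸 𝔹 × Rules.SeqSk 𝔸 𝔹 × Rules.rConseq 𝔸 𝔹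
theorem6p1 𝔸 𝔹 = dSeq , dIf , dWh , rDisj , SeqSk , rConseq
  where open BiKATProperties 𝔹
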